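{- Let $t,k,\ell\in\mathbb{N}$ and $r\in\mathbb{N}\cup\{\infty\}$ (with $3\cdot\infty=\infty$). For every $K_{t,t}$-free graph $G$, if $\mathrm{frk}_{3r,k}(G)\le\ell$ then $\mathrm{srk}_{r,k'}(G)\le\ell$, where $k'=k^{(2^\ell)}t^2$.
   Context: Graphs are finite, simple, undirected; $K_{t,t}$-free means no subgraph isomorphic to $K_{t,t}$. $B^r_H(v)$ is the set of vertices at distance at most $r$ from $v$ in $H$; $H[X]$ is the induced subgraph. Flipping $(A,B)$ in $G$ yields the graph on $V(G)$ with edge set (on distinct pairs) $E(G)\triangle\{ab:a\in A,b\in B\}$. A $k$-flip of $G$ is obtained by flipping some pairs $(A,B)$ with $A,B\in\mathcal{P}$ (possibly $A=B$) for a partition $\mathcal{P}$ of $V(G)$ with $|\mathcal{P}|\le k$. A $k$-deletion of $G$ is obtained by deleting at most $k$ vertices. Flipper-rank: $\mathrm{frk}_{r,k}(K_1)=1$ and for every other graph $G$, $\mathrm{frk}_{r,k}(G)=1+\min_H\max_{v\in V(H)}\mathrm{frk}_{r,k}(H[B^r_H(v)])$, the minimum over all $k$-flips $H$ of $G$. Splitter-rank $\mathrm{srk}_{r,k}$ is defined identically with $k$-flips replaced by $k$-deletions. -}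

module Defs where

open import Data.Nat using (ℕ; zero; suc; _≤_; _*_; _^_)
open import Data.Fin using (Fin)
open import Data.Fin.Properties using (_≟_)
open import Data.Bool using (Bool; true; false; _∧_; _∨_; _xor_; not)
open import Data.List using (List; length)
open import Data.List.Membership.Propositional using (_∈_)
open import Data.Product using (Σ; _×_; _,_)
open import Data.Unit using (⊤)
open import Data.Empty using (⊥)
open import Relation.Nullary using (¬_)
open import Relation.Nullary.Decidable using (⌊_⌋)
open import Relation.Binary.PropositionalEquality using (_≡_; _≢_)
open import Function.Definitions using (Injective)

data ℕ∞ : Set where
  fin : ℕ → ℕ∞
  ∞   : ℕ∞

3·_ : ℕ∞ → ℕ∞
3· fin r = fin (3 * r)
3· ∞     = ∞

_≤∞_ : ℕ → ℕ∞ → Set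
m ≤∞ fin r = m ≤ r
m ≤∞ ∞     = ⊤

Adj : ℕ → Set
Adj n = Fin n → Fin n → Bool

record SimpleGraph : Set where
  field
    n      : ℕ
    adj    : Adj n
    sym    : ∀ x y → adj x y ≡ adj y x
    irrefl : ∀ x → adj x x ≡ false
open SimpleGraph public

-- Throughout, an induced subgraph G[S] of a graph on Fin n is represented by
-- the pair (adjacency E on Fin n, vertex subset S : Fin n → Set).

data Walk {n : ℕ} (E : Adj n) (S : Fin n → Set) : Fin n → Fin n → ℕ → Set where
  here : ∀ {v} → S v → Walk E S v v zero
  step : ∀ {u w x m} → S u → E u w ≡ true → Walk E S w x m → Walk E S u x (suc m)

Ball : {n : ℕ} → ℕ∞ → Adj n → (Fin n → Set) → Fin n → Fin n → Set
Ball r E S v x = Σ ℕ λ m → (m ≤∞ r) × Walk E S v x m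

IsK1 : {n : ℕ} → (Fin n → Set) → Set
IsK1 {n} S = Σ (Fin n) λ v → S v × (∀ x → S x → x ≡ v)

-- Flipping (A, B) where A, B are the parts with labels i, j of the
-- partition given by the labelling c : Fin n → Fin k (parts = fibres of c,
-- so at most k parts).
flipPair : {n k : ℕ} → (Fin n → Fin k) → Fin k × Fin k → Adj n → Adj n
flipPair c (i , j) E x y =
  E x y xor (not ⌊ x ≟ y ⌋ ∧
             ((⌊ c x ≟ i ⌋ ∧ ⌊ c y ≟ j ⌋) ∨ (⌊ c x ≟ j ⌋ ∧ ⌊ c y ≟ i ⌋)))

flips : {n k : ℕ} → (Fin n → Fin k) → List (Fin k × Fin k) → Adj n → Adj n
flips c List.[] E = E
flips c (p List.∷ ps) E = flipPair c p (flips c ps E)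

-- FrkLE r k ℓ E S  :  frk_{r,k}(E[S]) ≤ ℓ   (least-fixed-point reading)
data FrkLE {n : ℕ} (r : ℕ∞) (k : ℕ) : ℕ → Adj n → (Fin n → Set) → Set₁ where
  k1   : ∀ {ℓ E S} → IsK1 S → FrkLE r k (suc ℓ) E S
  flip : ∀ {ℓ E S} (c : Fin n → Fin k) (ps : List (Fin k × Fin k)) →
         (∀ v → S v → FrkLE r k ℓ (flips c ps E) (Ball r (flips c ps E) S v)) →
         FrkLE r k (suc ℓ) E S

deleteV : {n : ℕ} → (Fin n → Set) → List (Fin n) → Fin n → Set
deleteV S D x = S x × ¬ (x ∈ D)

data SrkLE {n : ℕ} (r : ℕ∞) (k : ℕ) : ℕ → Adj n → (Fin n → Set) → Set₁ where
  k1     : ∀ {ℓ E S} → IsK1 S → SrkLE r k (suc ℓ) E S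
  delete : ∀ {ℓ E S} (D : List (Fin n)) → length D ≤ k →
           (∀ v → deleteV S D v → SrkLE r k ℓ E (Ball r E (deleteV S D) v)) →
           SrkLE r k (suc ℓ) E S

frk≤ : ℕ∞ → ℕ → SimpleGraph → ℕ → Set₁
frk≤ r k G ℓ = FrkLE r k ℓ (adj G) (λ _ → ⊤)

srk≤ : ℕ∞ → ℕ → SimpleGraph → ℕ → Set₁
srk≤ r k G ℓ = SrkLE r k ℓ (adj G) (λ _ → ⊤)

KttFree : ℕ → SimpleGraph → Set
KttFree t G =
  ¬ (Σ (Fin t → Fin (n G)) λ a → Σ (Fin t → Fin (n G)) λ b →
       Injective _≡_ _≡_ a × Injective _≡_ _≡_ b ×
       (∀ i j → a i ≢ b j) × (∀ i j → adj G (a i) (b j) ≡ true))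

module Submission where

-- The splitter follows the flipper's strategy for radius 3r. After d rounds the flipper's graph is
-- G flipped along a symmetric pattern between the parts of a labelling with at most k^d labels
-- (the common refinement of the partitions played). Call a part large if it has at least t² + t of
-- the current vertices. The splitter deletes the small parts and every vertex with fewer than t
-- non-neighbours in some large part; by K_{t,t}-freeness a large part has fewer than t such
-- vertices, so for k ≥ 2 at most k^d (t² + t) ≤ k^ℓ t² vertices are deleted (for k = 1 the single
-- part is large unless at most 2t² vertices remain, and those go in two rounds). If two remaining
-- vertices u, w are adjacent in G but not in the flipper's graph, their parts are flipped against
-- each other; u has t non-neighbours in the part of w and w has t in the part of u, and by
-- K_{t,t}-freeness some two of them, x and y, are non-adjacent, so u x y w (or u x w) is a path in
-- the flipper's graph. Hence every r-ball after the deletion lies inside the flipper's 3r-ball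
-- around the same vertex, and the splitter continues inside it. (The count only needs k′=k^ℓ·t².)

open import Defs hiding (sym)
open import Data.Nat using (ℕ; zero; suc; _+_; _*_; _∸_; _^_; _≤_; _<_; z≤n; s≤s; NonZero; >-nonZero)
open import Data.Nat.Properties hiding (_≟_)
open import Data.Nat.Induction using (<-rec)
open import Data.Fin using (Fin; zero; suc; toℕ; combine; remQuot)
open import Data.Fin.Properties using (_≟_; ¬Fin0; any?; pigeonhole; toℕ<n; remQuot-combine)
  renaming (suc-injective to Fin-suc-injective)
open import Data.Bool using (Bool; true; false; _∧_; _∨_; _xor_; not)
open import Data.Bool.Properties
  using (∧-comm; ∨-comm; ∧-zeroʳ; ∧-identityʳ; ∨-identityʳ; ∧-distribˡ-xor; xor-assoc; xor-identityʳ)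
  renaming (_≟_ to _≟ᵇ_)
open import Data.List using (List; []; _∷_; length; map; take; drop)
open import Data.List.Properties using (length-map; length-take; length-drop; take++drop≡id)
open import Data.List.Relation.Unary.Any using (here; there)
open import Data.List.Membership.Propositional using (_∈_)
open import Data.List.Membership.Propositional.Properties using (∈-++⁻; ∈-map⁺; ∈-map⁻)
open import Data.Product using (Σ; ∃; ∃₂; _×_; _,_; proj₁; proj₂)
open import Data.Sum using (_⊎_; inj₁; inj₂; [_,_]′)
open import Data.Unit using (⊤; tt)
open import Data.Empty using (⊥; ⊥-elim)
open import Function using (_∘_)
open import Function.Definitions using (Injective)
open import Relation.Nullary using (¬_; yes; no; Dec)
open import Relation.Nullary.Decidable using (⌊_⌋; _×-dec_; ¬?; map′; isYes≗does; dec-true; dec-false)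
open import Relation.Binary.PropositionalEquality

true≢false : true ≢ false
true≢false ()

true-or-false : ∀ b → b ≡ true ⊎ b ≡ false
true-or-false true = inj₁ refl
true-or-false false = inj₂ refl

∧-true : ∀ {a b} → a ≡ true → b ≡ true → a ∧ b ≡ true
∧-true refl refl = refl

∧-true⁻ˡ : ∀ {a b} → a ∧ b ≡ true → a ≡ true
∧-true⁻ˡ {true} _ = refl

∧-true⁻ʳ : ∀ {a b} → a ∧ b ≡ true → b ≡ true
∧-true⁻ʳ {true} e = e

∧-false⁻ʳ : ∀ {a b} → a ∧ b ≡ false → a ≡ true → b ≡ false
∧-false⁻ʳ e refl = e

∨-trueˡ : ∀ {a b} → a ≡ true → a ∨ b ≡ true
∨-trueˡ refl = refl

∨-trueʳ : ∀ {a b} → b ≡ true → a ∨ b ≡ true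
∨-trueʳ {true} _ = refl
∨-trueʳ {false} e = e

∨-false⁻ : ∀ {a b} → a ∨ b ≡ false → a ≡ false × b ≡ false
∨-false⁻ {false} e = refl , e

not-true⁻ : ∀ {a} → not a ≡ true → a ≡ false
not-true⁻ {false} _ = refl

not-false⁻ : ∀ {a} → not a ≡ false → a ≡ true
not-false⁻ {true} _ = refl

not-false : ∀ {a} → a ≡ false → not a ≡ true
not-false refl = refl

module _ {P : Set} where

  ⌊⌋-true : (d : Dec P) → P → ⌊ d ⌋ ≡ true
  ⌊⌋-true d p = trans (isYes≗does d) (dec-true d p)

  ⌊⌋-false : (d : Dec P) → ¬ P → ⌊ d ⌋ ≡ false
  ⌊⌋-false d np = trans (isYes≗does d) (dec-false d np)

  ⌊⌋-true⁻ : (d : Dec P) → ⌊ d ⌋ ≡ true → P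
  ⌊⌋-true⁻ (yes p) _ = p

  ⌊⌋-false⁻ : (d : Dec P) → ⌊ d ⌋ ≡ false → ¬ P
  ⌊⌋-false⁻ (no np) _ = np

n<2^n : ∀ n → n < 2 ^ n
n<2^n zero = s≤s z≤n
n<2^n (suc n) = begin-strict
  suc n            ≤⟨ n<2^n n ⟩
  2 ^ n            <⟨ m<m+n (2 ^ n) (m^n>0 2 n) ⟩
  2 ^ n + 2 ^ n    ≡⟨ cong (2 ^ n +_) (+-identityʳ (2 ^ n)) ⟨
  2 ^ suc n        ∎
  where open ≤-Reasoning

^-≤-^-2^ : ∀ k n → k ^ suc n ≤ k ^ 2 ^ suc n
^-≤-^-2^ zero n = z≤n
^-≤-^-2^ (suc k) n = ^-monoʳ-≤ (suc k) (<⇒≤ (n<2^n (suc n)))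

Fin-≤1-unique : ∀ {K} → K ≤ 1 → (α β : Fin K) → α ≡ β
Fin-≤1-unique (s≤s z≤n) zero zero = refl

Fin-nonempty : ∀ {K} → Fin K → 1 ≤ K
Fin-nonempty zero = s≤s z≤n
Fin-nonempty (suc _) = s≤s z≤n

-- Counting Boolean predicates on Fin n

count : ∀ {n} → (Fin n → Bool) → ℕ
count {zero} p = 0
count {suc n} p with p zero
... | true = suc (count (p ∘ suc))
... | false = count (p ∘ suc)

count-mono : ∀ {n} (p q : Fin n → Bool) → (∀ x → p x ≡ true → q x ≡ true) → count p ≤ count q
count-mono {zero} p q p⊆q = z≤n
count-mono {suc n} p q p⊆q with p zero in ep | q zero in eq
... | true | true = s≤s (count-mono (p ∘ suc) (q ∘ suc) (p⊆q ∘ suc))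
... | true | false = ⊥-elim (true≢false (trans (sym (p⊆q zero ep)) eq))
... | false | true = m≤n⇒m≤1+n (count-mono (p ∘ suc) (q ∘ suc) (p⊆q ∘ suc))
... | false | false = count-mono (p ∘ suc) (q ∘ suc) (p⊆q ∘ suc)

count-∨ : ∀ {n} (p q : Fin n → Bool) → count (λ x → p x ∨ q x) ≤ count p + count q
count-∨ {zero} p q = z≤n
count-∨ {suc n} p q with p zero | q zero | count-∨ (p ∘ suc) (q ∘ suc)
... | true | true | ih = s≤s (≤-trans ih (+-monoʳ-≤ (count (p ∘ suc)) (n≤1+n _)))
... | true | false | ih = s≤s ih
... | false | true | ih = ≤-trans (s≤s ih) (≤-reflexive (sym (+-suc (count (p ∘ suc)) _)))
... | false | false | ih = ih

count-≡0 : ∀ {n} (p : Fin n → Bool) → (∀ x → p x ≡ false) → count p ≡ 0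
count-≡0 {zero} p none = refl
count-≡0 {suc n} p none rewrite none zero = count-≡0 (p ∘ suc) (none ∘ suc)

count-cong : ∀ {n} (p q : Fin n → Bool) → (∀ x → p x ≡ q x) → count p ≡ count q
count-cong p q p≗q = ≤-antisym (count-mono p q (λ x e → trans (sym (p≗q x)) e))
                               (count-mono q p (λ x e → trans (p≗q x) e))

select : ∀ {n} t (p : Fin n → Bool) → t ≤ count p →
         Σ (Fin t → Fin n) λ f → Injective _≡_ _≡_ f × (∀ i → p (f i) ≡ true)
select zero p _ = (λ ()) , (λ {i} → ⊥-elim (¬Fin0 i)) , λ ()
select {zero} (suc t) p ()
select {suc n} (suc t) p t<count with p zero in e
... | true = cons , cons-injective , cons-selected
  where
  rest : Σ (Fin t → Fin n) λ f → Injective _≡_ _≡_ f × (∀ i → p (suc (f i)) ≡ true)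
  rest = select t (p ∘ suc) (≤-pred t<count)
  cons : Fin (suc t) → Fin (suc n)
  cons zero = zero
  cons (suc i) = suc (proj₁ rest i)
  cons-injective : Injective _≡_ _≡_ cons
  cons-injective {zero} {zero} _ = refl
  cons-injective {suc i} {suc j} eq = cong suc (proj₁ (proj₂ rest) (Fin-suc-injective eq))
  cons-selected : ∀ i → p (cons i) ≡ true
  cons-selected zero = e
  cons-selected (suc i) = proj₂ (proj₂ rest) i
... | false = let (f , f-injective , f-selected) = select (suc t) (p ∘ suc) t<count in
  suc ∘ f , f-injective ∘ Fin-suc-injective , f-selected

count-≤1 : ∀ {n} (p : Fin n → Bool) → (∀ x y → p x ≡ true → p y ≡ true → x ≡ y) → count p ≤ 1
count-≤1 p unique with count p ≤? 1
... | yes ≤1 = ≤1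
... | no >1 with select 2 p (≰⇒> >1)
...   | f , f-injective , f-selected with f-injective (unique _ _ (f-selected zero) (f-selected (suc zero)))
...     | ()

count-≟ : ∀ {n} (u : Fin n) → count (λ y → ⌊ y ≟ u ⌋) ≤ 1
count-≟ u = count-≤1 _ λ x y x≡u y≡u →
  trans (⌊⌋-true⁻ (x ≟ u) x≡u) (sym (⌊⌋-true⁻ (y ≟ u) y≡u))

anyᶠ : ∀ {K} → (Fin K → Bool) → Bool
anyᶠ {zero} f = false
anyᶠ {suc K} f = f zero ∨ anyᶠ (f ∘ suc)

anyᶠ-intro : ∀ {K} (f : Fin K → Bool) β → f β ≡ true → anyᶠ f ≡ true
anyᶠ-intro f zero e = ∨-trueˡ e
anyᶠ-intro f (suc β) e = ∨-trueʳ {f zero} (anyᶠ-intro (f ∘ suc) β e)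

anyᶠ-true⁻ : ∀ {K} (f : Fin K → Bool) → anyᶠ f ≡ true → ∃ λ β → f β ≡ true
anyᶠ-true⁻ {suc K} f e with f zero in e₀
... | true = zero , e₀
... | false = let (β , e′) = anyᶠ-true⁻ (f ∘ suc) e in suc β , e′

anyᶠ-false⁻ : ∀ {K} (f : Fin K → Bool) → anyᶠ f ≡ false → ∀ β → f β ≡ false
anyᶠ-false⁻ f e β with true-or-false (f β)
... | inj₁ t = ⊥-elim (true≢false (trans (sym (anyᶠ-intro f β t)) e))
... | inj₂ f = f

count-anyᶠ : ∀ {n K} c (q : Fin K → Fin n → Bool) → (∀ β → count (q β) ≤ c) →
             count (λ x → anyᶠ (λ β → q β x)) ≤ K * c
count-anyᶠ {n} {zero} c q _ = ≤-reflexive (count-≡0 {n} _ (λ _ → refl))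
count-anyᶠ {K = suc K} c q bound =
  ≤-trans (count-∨ (q zero) _) (+-mono-≤ (bound zero) (count-anyᶠ c (q ∘ suc) (bound ∘ suc)))

count-covered : ∀ {n K} c (p : Fin n → Bool) (q : Fin K → Fin n → Bool) →
                (∀ x → p x ≡ true → ∃ λ β → q β x ≡ true) → (∀ β → count (q β) ≤ c) →
                count p ≤ K * c
count-covered c p q cover bound =
  ≤-trans (count-mono p _ (λ x e → let (β , e′) = cover x e in anyᶠ-intro (λ β → q β x) β e′))
          (count-anyᶠ c q bound)

elements : ∀ {n} → (Fin n → Bool) → List (Fin n)
elements {zero} p = []
elements {suc n} p with p zero
... | true = zero ∷ map suc (elements (p ∘ suc))
... | false = map suc (elements (p ∘ suc))

length-elements : ∀ {n} (p : Fin n → Bool) → length (elements p) ≡ count p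
length-elements {zero} p = refl
length-elements {suc n} p with p zero
... | true = cong suc (trans (length-map suc (elements (p ∘ suc))) (length-elements (p ∘ suc)))
... | false = trans (length-map suc (elements (p ∘ suc))) (length-elements (p ∘ suc))

∈-elements⁺ : ∀ {n} (p : Fin n → Bool) x → p x ≡ true → x ∈ elements p
∈-elements⁺ {suc n} p x e with p zero in e₀
∈-elements⁺ {suc n} p zero e | true = here refl
∈-elements⁺ {suc n} p (suc x) e | true = there (∈-map⁺ suc (∈-elements⁺ (p ∘ suc) x e))
∈-elements⁺ {suc n} p zero e | false = ⊥-elim (true≢false (trans (sym e) e₀))
∈-elements⁺ {suc n} p (suc x) e | false = ∈-map⁺ suc (∈-elements⁺ (p ∘ suc) x e)

∈-elements⁻ : ∀ {n} (p : Fin n → Bool) x → x ∈ elements p → p x ≡ true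
∈-elements⁻ {suc n} p x x∈ with p zero in e₀
∈-elements⁻ {suc n} p x (here refl) | true = e₀
∈-elements⁻ {suc n} p x (there x∈) | true with ∈-map⁻ suc x∈
... | y , y∈ , refl = ∈-elements⁻ (p ∘ suc) y y∈
∈-elements⁻ {suc n} p x x∈ | false with ∈-map⁻ suc x∈
... | y , y∈ , refl = ∈-elements⁻ (p ∘ suc) y y∈

-- Walks and balls

module _ {n : ℕ} {E : Adj n} {S : Fin n → Set} where

  walk-head∈ : ∀ {v x m} → Walk E S v x m → S v
  walk-head∈ (here s) = s
  walk-head∈ (step s _ _) = s

  walk-last∈ : ∀ {v x m} → Walk E S v x m → S x
  walk-last∈ (here s) = s
  walk-last∈ (step _ _ w) = walk-last∈ w

  _++ʷ_ : ∀ {v y x a b} → Walk E S v y a → Walk E S y x b → Walk E S v x (a + b)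
  here _ ++ʷ w = w
  step s e w ++ʷ w′ = step s e (w ++ʷ w′)

  vertexAt : ∀ {v x m} → Walk E S v x m → Fin (suc m) → Fin n
  vertexAt {v} w zero = v
  vertexAt (step _ _ w) (suc i) = vertexAt w i

  takeʷ : ∀ {v x m} (w : Walk E S v x m) (i : Fin (suc m)) → Walk E S v (vertexAt w i) (toℕ i)
  takeʷ w zero = here (walk-head∈ w)
  takeʷ (step s e w) (suc i) = step s e (takeʷ w i)

  dropʷ : ∀ {v x m} (w : Walk E S v x m) (i : Fin (suc m)) → Walk E S (vertexAt w i) x (m ∸ toℕ i)
  dropʷ w zero = w
  dropʷ (step _ _ w) (suc i) = dropʷ w i

  ShortWalk : Fin n → Fin n → Set
  ShortWalk v x = ∃ λ m → m ≤ n × Walk E S v x m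

  -- A walk with more than n steps repeats a vertex; cutting out the cycle shortens it.
  shortWalk : ∀ m {v x} → Walk E S v x m → ShortWalk v x
  shortWalk = <-rec (λ m → ∀ {v x} → Walk E S v x m → ShortWalk v x) shorten
    where
    shorten : ∀ m → (∀ {m′} → m′ < m → ∀ {v x} → Walk E S v x m′ → ShortWalk v x) →
              ∀ {v x} → Walk E S v x m → ShortWalk v x
    shorten m rec {v} {x} w with m ≤? n
    ... | yes m≤n = m , m≤n , w
    ... | no m≰n with pigeonhole (≤-trans (≰⇒> m≰n) (n≤1+n m)) (vertexAt w)
    ... | i , j , i<j , same = rec shorter (takeʷ w i ++ʷ subst (λ y → Walk E S y x _) (sym same) (dropʷ w j))
      where
      shorter : toℕ i + (m ∸ toℕ j) < m
      shorter = ≤-trans (+-monoˡ-≤ (m ∸ toℕ j) i<j) (≤-reflexive (m+[n∸m]≡n (≤-pred (toℕ<n j))))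

module _ {n : ℕ} (E : Adj n) {S : Fin n → Set} (S? : ∀ x → Dec (S x)) where

  walk? : ∀ m v x → Dec (Walk E S v x m)
  walk? zero v x with S? v | v ≟ x
  ... | yes s | yes refl = yes (here s)
  ... | no ¬s | _ = no λ { (here s) → ¬s s }
  ... | yes _ | no v≢x = no λ { (here _) → v≢x refl }
  walk? (suc m) v x with S? v | any? (λ w → (E v w ≟ᵇ true) ×-dec walk? m w x)
  ... | yes s | yes (w , e , rest) = yes (step s e rest)
  ... | no ¬s | _ = no λ { (step s _ _) → ¬s s }
  ... | yes _ | no ¬next = no λ { (step {w = w} _ e rest) → ¬next (w , e , rest) }

  ball? : ∀ r v x → Dec (Ball r E S v x)
  ball? (fin m) v x = map′ (λ (j , j<1+m , w) → j , ≤-pred j<1+m , w) (λ (j , j≤m , w) → j , s≤s j≤m , w)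
                           (anyUpTo? (λ j → walk? j v x) (suc m))
  ball? ∞ v x = map′ (λ (j , _ , w) → j , tt , w)
                     (λ (j , _ , w) → let (m , m≤n , w′) = shortWalk j w in m , s≤s m≤n , w′)
                     (anyUpTo? (λ j → walk? j v x) (suc n))

¬frk-zero : ∀ {n r k} {E : Adj n} {S} → ¬ FrkLE r k 0 E S
¬frk-zero ()

srk-empty : ∀ {n r k m} {E : Adj n} {S : Fin n → Set} → (∀ x → ¬ S x) → SrkLE r k (suc m) E S
srk-empty empty = delete [] z≤n λ v (v∈S , _) → ⊥-elim (empty v v∈S)

srk-small : ∀ {n r k m} {E : Adj n} {S : Fin n → Set} (S? : ∀ x → Dec (S x)) →
            count (λ x → ⌊ S? x ⌋) ≤ k + k → SrkLE r k (suc (suc m)) E S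
srk-small {k = k} {S = S} S? small =
  delete (take k L) (≤-trans (≤-reflexive (length-take k L)) (m⊓n≤m k _)) λ v _ →
  delete (drop k L) (≤-trans (≤-reflexive (length-drop k L)) (m≤n+o⇒m∸n≤o _ k L≤k+k))
  λ x (x∈ball , x∉drop) →
  let (x∈S , x∉take) = walk-last∈ (proj₂ (proj₂ x∈ball)) in
  ⊥-elim ([ x∉take , x∉drop ]′ (∈-++⁻ (take k L) (subst (x ∈_) (sym (take++drop≡id k L)) (x∈L x x∈S))))
  where
  L : List (Fin _)
  L = elements (λ x → ⌊ S? x ⌋)
  L≤k+k : length L ≤ k + k
  L≤k+k = ≤-trans (≤-reflexive (length-elements (λ x → ⌊ S? x ⌋))) small
  x∈L : ∀ x → S x → x ∈ L
  x∈L x x∈S = ∈-elements⁺ _ x (⌊⌋-true (S? x) x∈S)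

≤∞-3· : ∀ r {m m′} → m ≤∞ r → m′ ≤ 3 * m → m′ ≤∞ (3· r)
≤∞-3· (fin _) m≤r m′≤3m = ≤-trans m′≤3m (*-monoʳ-≤ 3 m≤r)
≤∞-3· ∞ _ _ = tt

-- Accumulated flips

cross : ∀ {k} → Fin k × Fin k → Fin k → Fin k → Bool
cross (i , j) a b = (⌊ a ≟ i ⌋ ∧ ⌊ b ≟ j ⌋) ∨ (⌊ a ≟ j ⌋ ∧ ⌊ b ≟ i ⌋)

parity : ∀ {k} → List (Fin k × Fin k) → Fin k → Fin k → Bool
parity [] a b = false
parity (p ∷ ps) a b = parity ps a b xor cross p a b

cross-sym : ∀ {k} (p : Fin k × Fin k) a b → cross p a b ≡ cross p b a
cross-sym (i , j) a b =
  trans (cong₂ _∨_ (∧-comm ⌊ a ≟ i ⌋ ⌊ b ≟ j ⌋) (∧-comm ⌊ a ≟ j ⌋ ⌊ b ≟ i ⌋))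
        (∨-comm (⌊ b ≟ j ⌋ ∧ ⌊ a ≟ i ⌋) _)

parity-sym : ∀ {k} (ps : List (Fin k × Fin k)) a b → parity ps a b ≡ parity ps b a
parity-sym [] a b = refl
parity-sym (p ∷ ps) a b = cong₂ _xor_ (parity-sym ps a b) (cross-sym p a b)

-- Every graph reached from A by successive flips has this form: lab is the common refinement
-- of the partitions used so far, and F α β records whether the pair of parts α, β is flipped.
flipBy : ∀ {n K} → Adj n → (Fin n → Fin K) → (Fin K → Fin K → Bool) → Adj n
flipBy A lab F x y = A x y xor (not ⌊ x ≟ y ⌋ ∧ F (lab x) (lab y))

flips-xor : ∀ {n k} (A E : Adj n) (Φ : Fin n → Fin n → Bool) (c : Fin n → Fin k) →
            (∀ x y → E x y ≡ A x y xor (not ⌊ x ≟ y ⌋ ∧ Φ x y)) →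
            ∀ ps x y → flips c ps E x y ≡ A x y xor (not ⌊ x ≟ y ⌋ ∧ (Φ x y xor parity ps (c x) (c y)))
flips-xor A E Φ c E≡ [] x y =
  trans (E≡ x y) (cong (λ b → A x y xor (not ⌊ x ≟ y ⌋ ∧ b)) (sym (xor-identityʳ _)))
flips-xor A E Φ c E≡ (p ∷ ps) x y = begin
    flips c ps E x y xor (distinct ∧ cross p (c x) (c y))
  ≡⟨ cong (_xor (distinct ∧ cross p (c x) (c y))) (flips-xor A E Φ c E≡ ps x y) ⟩
    (A x y xor (distinct ∧ (Φ x y xor parity ps (c x) (c y)))) xor (distinct ∧ cross p (c x) (c y))
  ≡⟨ xor-assoc (A x y) _ _ ⟩
    A x y xor ((distinct ∧ (Φ x y xor parity ps (c x) (c y))) xor (distinct ∧ cross p (c x) (c y)))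
  ≡⟨ cong (A x y xor_) (sym (∧-distribˡ-xor distinct _ _)) ⟩
    A x y xor (distinct ∧ ((Φ x y xor parity ps (c x) (c y)) xor cross p (c x) (c y)))
  ≡⟨ cong (λ b → A x y xor (distinct ∧ b)) (xor-assoc (Φ x y) _ _) ⟩
    A x y xor (distinct ∧ (Φ x y xor parity (p ∷ ps) (c x) (c y)))
  ∎
  where
  open ≡-Reasoning
  distinct : Bool
  distinct = not ⌊ x ≟ y ⌋

refine : ∀ {n K k} → (Fin n → Fin K) → (Fin n → Fin k) → Fin n → Fin (K * k)
refine lab c x = combine (lab x) (c x)

refinePattern : ∀ {K k} → (Fin K → Fin K → Bool) → List (Fin k × Fin k) → Fin (K * k) → Fin (K * k) → Bool
refinePattern {K} {k} F ps a b =
  F (proj₁ (remQuot {K} k a)) (proj₁ (remQuot {K} k b))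
    xor parity ps (proj₂ (remQuot {K} k a)) (proj₂ (remQuot {K} k b))

refinePattern-sym : ∀ {K k} (F : Fin K → Fin K → Bool) → (∀ α β → F α β ≡ F β α) →
                    (ps : List (Fin k × Fin k)) → ∀ a b → refinePattern F ps a b ≡ refinePattern F ps b a
refinePattern-sym F F-sym ps a b = cong₂ _xor_ (F-sym _ _) (parity-sym ps _ _)

flips-flipBy : ∀ {n K k} (A E : Adj n) (lab : Fin n → Fin K) (F : Fin K → Fin K → Bool) (c : Fin n → Fin k) →
               (∀ x y → E x y ≡ flipBy A lab F x y) →
               ∀ ps x y → flips c ps E x y ≡ flipBy A (refine lab c) (refinePattern F ps) x y
flips-flipBy {k = k} A E lab F c E≡ ps x y =
  trans (flips-xor A E (λ x y → F (lab x) (lab y)) c E≡ ps x y)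
        (cong (λ b → A x y xor (not ⌊ x ≟ y ⌋ ∧ b))
              (sym (cong₂ (λ a b → F (proj₁ a) (proj₁ b) xor parity ps (proj₂ a) (proj₂ b))
                          (remQuot-combine {k = k} (lab x) (c x)) (remQuot-combine {k = k} (lab y) (c y)))))

KttFree-nonZero : ∀ {t} (G : SimpleGraph) → KttFree t G → NonZero t
KttFree-nonZero {zero} G free =
  ⊥-elim (free (none , none , (λ {i} → ⊥-elim (¬Fin0 i)) , (λ {i} → ⊥-elim (¬Fin0 i)) , (λ ()) , (λ ())))
  where
  none : Fin 0 → Fin (n G)
  none ()
KttFree-nonZero {suc t} G free = _

module Splitter (G : SimpleGraph) {t : ℕ} .{{_ : NonZero t}} (free : KttFree t G) where

  N : ℕ
  N = n G

  A : Adj N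
  A = adj G

  sym-adj : ∀ x y → A x y ≡ A y x
  sym-adj = SimpleGraph.sym G

  no-biclique : (a b : Fin t → Fin N) → Injective _≡_ _≡_ a → Injective _≡_ _≡_ b →
                (∀ i j → A (a i) (b j) ≡ true) → ⊥
  no-biclique a b a-injective b-injective complete = free (a , b , a-injective , b-injective , disjoint , complete)
    where
    disjoint : ∀ i j → a i ≢ b j
    disjoint i j a≡b = true≢false (trans (sym (complete i j)) (trans (cong (A (a i)) (sym a≡b)) (irrefl G (a i))))

  nonadjacent-pair : (X Y : Fin N → Bool) → t ≤ count X → t ≤ count Y →
                     ∃₂ λ x y → X x ≡ true × Y y ≡ true × A x y ≡ false
  nonadjacent-pair X Y t≤X t≤Y
    with any? (λ x → any? (λ y → (X x ≟ᵇ true) ×-dec (Y y ≟ᵇ true) ×-dec (A x y ≟ᵇ false)))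
  ... | yes found = found
  ... | no none with select t X t≤X | select t Y t≤Y
  ...   | a , a-injective , a∈X | b , b-injective , b∈Y = ⊥-elim (no-biclique a b a-injective b-injective complete)
    where
    complete : ∀ i j → A (a i) (b j) ≡ true
    complete i j with true-or-false (A (a i) (b j))
    ... | inj₁ adjacent = adjacent
    ... | inj₂ nonadjacent = ⊥-elim (none (a i , b j , a∈X i , b∈Y j , nonadjacent))

  module Parts {K : ℕ} (lab : Fin N → Fin K) (V : Fin N → Bool) where

    inPart : Fin K → Fin N → Bool
    inPart β y = V y ∧ ⌊ lab y ≟ β ⌋

    nonNbr : Fin N → Fin K → Fin N → Bool
    nonNbr u β y = inPart β y ∧ (not ⌊ y ≟ u ⌋ ∧ not (A u y))

    large : Fin K → Bool
    large β = ⌊ t * t + t ≤? count (inPart β) ⌋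

    fewNonNbrs : Fin K → Fin N → Bool
    fewNonNbrs β u = ⌊ count (nonNbr u β) <? t ⌋

    -- t vertices with fewer than t non-neighbours each in a part of size t² + t would,
    -- together with t of the remaining vertices of that part, form a K_{t,t}.
    count-fewNonNbrs : ∀ β → large β ≡ true → count (fewNonNbrs β) < t
    count-fewNonNbrs β β-large with t ≤? count (fewNonNbrs β)
    ... | no ≱t = ≰⇒> ≱t
    ... | yes ≥t with select t (fewNonNbrs β) ≥t
    ...   | u , u-injective , u-few = ⊥-elim (no-biclique u b u-injective b-injective complete)
      where
      near : Fin N → Bool
      near y = anyᶠ (λ i → ⌊ y ≟ u i ⌋ ∨ nonNbr (u i) β y)
      far : Fin N → Bool
      far y = inPart β y ∧ not (near y)
      count-near : count near ≤ t * t
      count-near = count-anyᶠ t (λ i y → ⌊ y ≟ u i ⌋ ∨ nonNbr (u i) β y) λ i →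
        ≤-trans (count-∨ (λ y → ⌊ y ≟ u i ⌋) (nonNbr (u i) β))
                (≤-trans (+-monoˡ-≤ _ (count-≟ (u i))) (⌊⌋-true⁻ (_ <? t) (u-few i)))
      near-or-far : ∀ y → inPart β y ≡ true → near y ∨ far y ≡ true
      near-or-far y y∈β with near y
      ... | true = refl
      ... | false = ∧-true y∈β refl
      t≤far : t ≤ count far
      t≤far = +-cancelˡ-≤ (t * t) t (count far) (begin
        t * t + t                  ≤⟨ ⌊⌋-true⁻ (_ ≤? _) β-large ⟩
        count (inPart β)           ≤⟨ count-mono (inPart β) _ near-or-far ⟩
        count (λ y → near y ∨ far y) ≤⟨ count-∨ near far ⟩
        count near + count far     ≤⟨ +-monoˡ-≤ (count far) count-near ⟩
        t * t + count far          ∎)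
        where open ≤-Reasoning
      b : Fin t → Fin N
      b = proj₁ (select t far t≤far)
      b-injective : Injective _≡_ _≡_ b
      b-injective = proj₁ (proj₂ (select t far t≤far))
      b-far : ∀ j → far (b j) ≡ true
      b-far = proj₂ (proj₂ (select t far t≤far))
      complete : ∀ i j → A (u i) (b j) ≡ true
      complete i j with ∨-false⁻ {⌊ b j ≟ u i ⌋} (anyᶠ-false⁻ (λ i → ⌊ b j ≟ u i ⌋ ∨ nonNbr (u i) β (b j))
                                                            (not-true⁻ (∧-true⁻ʳ {inPart β (b j)} (b-far j))) i)
      ... | b≢u , not-nonNbr =
        not-false⁻ (∧-false⁻ʳ (∧-false⁻ʳ {inPart β (b j)} not-nonNbr (∧-true⁻ˡ (b-far j)))
                               (not-false b≢u))

    nearlyComplete : Fin N → Fin K → Bool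
    nearlyComplete x β = large β ∧ fewNonNbrs β x

    deleted : Fin N → Bool
    deleted x = V x ∧ (not (large (lab x)) ∨ anyᶠ (nearlyComplete x))

    deletedFor : Fin K → Fin N → Bool
    deletedFor β x = (inPart β x ∧ not (large β)) ∨ nearlyComplete x β

    deleted-covered : ∀ x → deleted x ≡ true → ∃ λ β → deletedFor β x ≡ true
    deleted-covered x x-deleted with true-or-false (large (lab x))
    ... | inj₂ part-small = lab x , ∨-trueˡ (∧-true x∈part (not-false part-small))
      where
      x∈part : inPart (lab x) x ≡ true
      x∈part = ∧-true (∧-true⁻ˡ {V x} x-deleted) (⌊⌋-true (lab x ≟ lab x) refl)
    ... | inj₁ part-large
      with anyᶠ-true⁻ (nearlyComplete x)
             (subst (λ L → not L ∨ anyᶠ (nearlyComplete x) ≡ true) part-large (∧-true⁻ʳ {V x} x-deleted))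
    ...   | β , β-few = β , ∨-trueʳ {inPart β x ∧ not (large β)} β-few

    count-deletedFor-large : ∀ β → large β ≡ true → count (deletedFor β) ≤ t
    count-deletedFor-large β β-large =
      ≤-trans (count-mono (deletedFor β) (fewNonNbrs β) only-few) (<⇒≤ (count-fewNonNbrs β β-large))
      where
      only-few : ∀ x → deletedFor β x ≡ true → fewNonNbrs β x ≡ true
      only-few x e rewrite β-large | ∧-zeroʳ (inPart β x) = e

    count-deletedFor-small : ∀ β → large β ≡ false → count (deletedFor β) ≤ t * t + t
    count-deletedFor-small β β-small =
      ≤-trans (count-mono (deletedFor β) (inPart β) only-inPart)
              (<⇒≤ (≰⇒> (⌊⌋-false⁻ (_ ≤? _) β-small)))
      where
      only-inPart : ∀ x → deletedFor β x ≡ true → inPart β x ≡ true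
      only-inPart x e rewrite β-small | ∧-identityʳ (inPart β x) | ∨-identityʳ (inPart β x) = e

    count-deleted : count deleted ≤ K * (t * t + t)
    count-deleted = count-covered _ deleted deletedFor deleted-covered bound
      where
      bound : ∀ β → count (deletedFor β) ≤ t * t + t
      bound β with true-or-false (large β)
      ... | inj₁ β-large = ≤-trans (count-deletedFor-large β β-large) (m≤n+m t (t * t))
      ... | inj₂ β-small = count-deletedFor-small β β-small

    count-deleted-allLarge : (∀ β → large β ≡ true) → count deleted ≤ K * t
    count-deleted-allLarge all-large =
      count-covered _ deleted deletedFor deleted-covered (λ β → count-deletedFor-large β (all-large β))

    Survives : Fin N → Set
    Survives x = V x ≡ true × deleted x ≡ false

    survivor-large : ∀ {u} → Survives u → large (lab u) ≡ true
    survivor-large {u} (u∈V , u-kept) =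
      not-false⁻ (proj₁ (∨-false⁻ {not (large (lab u))} (∧-false⁻ʳ {V u} u-kept u∈V)))

    survivor-manyNonNbrs : ∀ {u} → Survives u → ∀ β → large β ≡ true → t ≤ count (nonNbr u β)
    survivor-manyNonNbrs {u} (u∈V , u-kept) β β-large = ≮⇒≥ (⌊⌋-false⁻ (_ <? t) not-few)
      where
      not-nearlyComplete : anyᶠ (nearlyComplete u) ≡ false
      not-nearlyComplete = proj₂ (∨-false⁻ {not (large (lab u))} (∧-false⁻ʳ {V u} u-kept u∈V))
      not-few : fewNonNbrs β u ≡ false
      not-few = ∧-false⁻ʳ (anyᶠ-false⁻ (nearlyComplete u) not-nearlyComplete β) β-large

    nonNbr⁻ : ∀ {u β x} → nonNbr u β x ≡ true → V x ≡ true × lab x ≡ β × x ≢ u × A u x ≡ false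
    nonNbr⁻ {u} {β} {x} e =
      ∧-true⁻ˡ {V x} x∈β , ⌊⌋-true⁻ (lab x ≟ β) (∧-true⁻ʳ {V x} x∈β) ,
      ⌊⌋-false⁻ (x ≟ u) (not-true⁻ (∧-true⁻ˡ distinct-nonadjacent)) ,
      not-true⁻ (∧-true⁻ʳ {not ⌊ x ≟ u ⌋} distinct-nonadjacent)
      where
      x∈β : inPart β x ≡ true
      x∈β = ∧-true⁻ˡ {inPart β x} e
      distinct-nonadjacent : not ⌊ x ≟ u ⌋ ∧ not (A u x) ≡ true
      distinct-nonadjacent = ∧-true⁻ʳ {inPart β x} e

    module Lifting (F : Fin K → Fin K → Bool) (F-sym : ∀ α β → F α β ≡ F β α)
                   (E : Adj N) (E≡ : ∀ x y → E x y ≡ flipBy A lab F x y)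
                   (S : Fin N → Set) (V⊆S : ∀ x → V x ≡ true → S x) where

      flipped-edge : ∀ a b → A a b ≡ false → a ≢ b → F (lab a) (lab b) ≡ true → E a b ≡ true
      flipped-edge a b nonadjacent a≢b flipped
        rewrite E≡ a b | nonadjacent | ⌊⌋-false (a ≟ b) a≢b | flipped = refl

      lost-edge-flipped : ∀ u w → E u w ≡ false → A u w ≡ true → F (lab u) (lab w) ≡ true
      lost-edge-flipped u w lost adjacent with u ≟ w | true-or-false (F (lab u) (lab w))
      ... | yes refl | _ = ⊥-elim (true≢false (trans (sym adjacent) (irrefl G u)))
      ... | no _ | inj₁ flipped = flipped
      ... | no u≢w | inj₂ unflipped = ⊥-elim (true≢false (trans (sym kept) lost))
        where
        kept : E u w ≡ true
        kept rewrite E≡ u w | adjacent | ⌊⌋-false (u ≟ w) u≢w | unflipped = refl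

      hop-in : ∀ {u w x} → F (lab u) (lab w) ≡ true → nonNbr u (lab w) x ≡ true → E u x ≡ true
      hop-in {u} {w} {x} F-uw x-nonNbr with nonNbr⁻ x-nonNbr
      ... | _ , lab-x , x≢u , u≁x =
        flipped-edge u x u≁x (x≢u ∘ sym) (subst (λ β → F (lab u) β ≡ true) (sym lab-x) F-uw)

      hop-out : ∀ {u w y} → F (lab u) (lab w) ≡ true → nonNbr w (lab u) y ≡ true → E y w ≡ true
      hop-out {u} {w} {y} F-uw y-nonNbr with nonNbr⁻ y-nonNbr
      ... | _ , lab-y , y≢w , w≁y =
        flipped-edge y w (trans (sym-adj y w) w≁y) y≢w (subst (λ α → F α (lab w) ≡ true) (sym lab-y) F-uw)

      hop-across : ∀ {u w x y} → F (lab u) (lab w) ≡ true →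
                   nonNbr u (lab w) x ≡ true → nonNbr w (lab u) y ≡ true →
                   A x y ≡ false → x ≢ y → E x y ≡ true
      hop-across {u} {w} {x} {y} F-uw x-nonNbr y-nonNbr x≁y x≢y =
        flipped-edge x y x≁y x≢y (subst₂ (λ β α → F β α ≡ true) (sym (proj₁ (proj₂ (nonNbr⁻ x-nonNbr))))
                                          (sym (proj₁ (proj₂ (nonNbr⁻ y-nonNbr)))) (trans (F-sym _ _) F-uw))

      -- An edge uw of G missing from E is replaced by u x (y) w, where x is a non-neighbour of u
      -- in the part of w, y one of w in the part of u, and x, y are non-adjacent: each of these
      -- pairs is non-adjacent in G across the flipped pair of parts, hence adjacent in E.
      detour : ∀ u w → Survives u → Survives w → A u w ≡ true → ∃ λ m → m ≤ 3 × Walk E S u w m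
      detour u w (u∈V , u-kept) (w∈V , w-kept) adjacent with true-or-false (E u w)
      ... | inj₁ kept = 1 , s≤s z≤n , step (V⊆S u u∈V) kept (here (V⊆S w w∈V))
      ... | inj₂ lost
        with lost-edge-flipped u w lost adjacent
           | nonadjacent-pair (nonNbr u (lab w)) (nonNbr w (lab u))
               (survivor-manyNonNbrs (u∈V , u-kept) (lab w) (survivor-large (w∈V , w-kept)))
               (survivor-manyNonNbrs (w∈V , w-kept) (lab u) (survivor-large (u∈V , u-kept)))
      ...   | F-uw | x , y , x-nonNbr , y-nonNbr , x≁y with x ≟ y
      ...     | yes refl = 2 , s≤s (s≤s z≤n) ,
        step (V⊆S u u∈V) (hop-in F-uw x-nonNbr)
        (step (V⊆S x (proj₁ (nonNbr⁻ x-nonNbr))) (hop-out F-uw y-nonNbr) (here (V⊆S w w∈V)))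
      ...     | no x≢y = 3 , ≤-refl ,
        step (V⊆S u u∈V) (hop-in F-uw x-nonNbr)
        (step (V⊆S x (proj₁ (nonNbr⁻ x-nonNbr))) (hop-across F-uw x-nonNbr y-nonNbr x≁y x≢y)
        (step (V⊆S y (proj₁ (nonNbr⁻ y-nonNbr))) (hop-out F-uw y-nonNbr) (here (V⊆S w w∈V))))

      lift-walk : ∀ {P : Fin N → Set} → (∀ y → P y → Survives y) →
                  ∀ {v x m} → Walk A P v x m → ∃ λ m′ → m′ ≤ 3 * m × Walk E S v x m′
      lift-walk survives (here p) = 0 , z≤n , here (V⊆S _ (proj₁ (survives _ p)))
      lift-walk survives (step {u} {w} p adjacent rest)
        with detour u w (survives u p) (survives w (walk-head∈ rest)) adjacent | lift-walk survives rest
      ... | m₁ , m₁≤3 , hop | m₂ , m₂≤3m , walk =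
        m₁ + m₂ , ≤-trans (+-mono-≤ m₁≤3 m₂≤3m) (≤-reflexive (sym (*-distribˡ-+ 3 1 _))) , hop ++ʷ walk

      lift-ball : ∀ {P : Fin N → Set} → (∀ y → P y → Survives y) →
                  ∀ r {v x} → Ball r A P v x → Ball (3· r) E S v x
      lift-ball survives r (m , m≤r , walk) with lift-walk survives walk
      ... | m′ , m′≤3m , walk′ = m′ , ≤∞-3· r m≤r m′≤3m , walk′

  module Following (r : ℕ∞) (k B : ℕ) (tight : k ≡ 1 → B ≤ t * t) where

    -- For k ≥ 2 the factor k^(m+1) ≥ 2 absorbs the extra t in the bound t² + t on a small part.
    -- For k = 1, tight leaves room for a single part only, and that part is large because V is.
    deletion-budget : ∀ {K} m (lab : Fin N → Fin K) (V : Fin N → Bool) → 1 ≤ k →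
                      K * k ^ suc m * (t * t) ≤ B → B + B < count V → count (Parts.deleted lab V) ≤ B
    deletion-budget {K} m lab V 1≤k within large-V with m≤n⇒m<n∨m≡n 1≤k
    ... | inj₁ 2≤k = begin
      count deleted              ≤⟨ count-deleted ⟩
      K * (t * t + t)            ≤⟨ *-monoʳ-≤ K (+-monoʳ-≤ (t * t) (m≤m*n t t)) ⟩
      K * (t * t + t * t)        ≡⟨ cong (λ x → K * (t * t + x)) (+-identityʳ (t * t)) ⟨
      K * (2 * (t * t))          ≤⟨ *-monoʳ-≤ K (*-monoˡ-≤ (t * t) 2≤k^1+m) ⟩
      K * (k ^ suc m * (t * t))  ≡⟨ *-assoc K _ _ ⟨
      K * k ^ suc m * (t * t)    ≤⟨ within ⟩
      B                          ∎
      where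
      open Parts lab V
      open ≤-Reasoning
      2≤k^1+m : 2 ≤ k ^ suc m
      2≤k^1+m = ≤-trans 2≤k (m≤m*n k (k ^ m) {{m^n≢0 k m {{>-nonZero 1≤k}}}})
    ... | inj₂ 1≡k = begin
      count deleted              ≤⟨ count-deleted-allLarge all-large ⟩
      K * t                      ≤⟨ *-monoʳ-≤ K (m≤m*n t t) ⟩
      K * (t * t)                ≤⟨ K·t²≤B ⟩
      B                          ∎
      where
      open Parts lab V
      open ≤-Reasoning
      K·t²≤B : K * (t * t) ≤ B
      K·t²≤B = subst (λ x → x * (t * t) ≤ B)
                     (trans (cong (K *_) (trans (cong (_^ suc m) (sym 1≡k)) (^-zeroˡ (suc m)))) (*-identityʳ K)) within
      K≤1 : K ≤ 1
      K≤1 = *-cancelʳ-≤ K 1 (t * t) {{m*n≢0 t t}}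
              (≤-trans K·t²≤B (≤-trans (tight (sym 1≡k)) (≤-reflexive (sym (*-identityˡ (t * t))))))
      all-large : ∀ β → large β ≡ true
      all-large β = ⌊⌋-true (_ ≤? _) (begin
        t * t + t         ≤⟨ +-monoʳ-≤ (t * t) (m≤m*n t t) ⟩
        t * t + t * t     ≤⟨ +-mono-≤ t²≤B t²≤B ⟩
        B + B             ≤⟨ <⇒≤ large-V ⟩
        count V           ≡⟨ count-cong V (inPart β) V≗part ⟩
        count (inPart β)  ∎)
        where
        t²≤B : t * t ≤ B
        t²≤B = ≤-trans (≤-reflexive (sym (*-identityˡ (t * t))))
                       (≤-trans (*-monoˡ-≤ (t * t) (Fin-nonempty β)) K·t²≤B)
        V≗part : ∀ y → V y ≡ inPart β y
        V≗part y rewrite ⌊⌋-true (lab y ≟ β) (Fin-≤1-unique K≤1 (lab y) β) = sym (∧-identityʳ (V y))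

    -- Each round of the flipper refines lab by a k-partition, so K · k^m is constant along the play.
    follow : ∀ {m E S} → FrkLE (3· r) k m E S →
             ∀ {K} (lab : Fin N → Fin K) (F : Fin K → Fin K → Bool) → (∀ α β → F α β ≡ F β α) →
             (∀ x y → E x y ≡ flipBy A lab F x y) → K * k ^ m * (t * t) ≤ B →
             (S′ : Fin N → Set) → (∀ x → Dec (S′ x)) → (∀ x → S′ x → S x) → SrkLE r B m A S′
    follow (k1 (v , _ , unique)) lab F F-sym E≡ within S′ S′? S′⊆S with S′? v
    ... | yes v∈S′ = k1 (v , v∈S′ , λ x x∈S′ → unique x (S′⊆S x x∈S′))
    ... | no v∉S′ = srk-empty λ x x∈S′ → v∉S′ (subst S′ (unique x (S′⊆S x x∈S′)) x∈S′)
    follow (flip c ps next) lab F F-sym E≡ within S′ S′? S′⊆S with any? S′?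
    ... | no empty = srk-empty λ x x∈S′ → empty (x , x∈S′)
    follow {suc zero} (flip c ps next) lab F F-sym E≡ within S′ S′? S′⊆S
      | yes (x₀ , x₀∈S′) = ⊥-elim (¬frk-zero (next x₀ (S′⊆S x₀ x₀∈S′)))
    follow {suc (suc m)} {E} {S} (flip c ps next) {K} lab F F-sym E≡ within S′ S′? S′⊆S
      | yes (x₀ , x₀∈S′) with count (λ x → ⌊ S′? x ⌋) ≤? B + B
    ... | yes small = srk-small S′? small
    ... | no ¬small = delete D D≤B λ v v∈S′∖D →
          follow (next v (S′⊆S v (proj₁ v∈S′∖D)))
                 (refine lab c) (refinePattern F ps) (refinePattern-sym F F-sym ps)
                 (flips-flipBy A E lab F c E≡ ps) within′
                 (Ball r A (deleteV S′ D) v) (ball? A S′∖D? r v) (λ x → lift-ball survives r)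
      where
      V : Fin N → Bool
      V x = ⌊ S′? x ⌋
      open Parts (refine lab c) V
      open Lifting (refinePattern F ps) (refinePattern-sym F F-sym ps) (flips c ps E) (flips-flipBy A E lab F c E≡ ps)
                   S (λ x x∈V → S′⊆S x (⌊⌋-true⁻ (S′? x) x∈V))
      D : List (Fin N)
      D = elements deleted
      within′ : K * k * k ^ suc m * (t * t) ≤ B
      within′ = subst (λ x → x * (t * t) ≤ B) (sym (*-assoc K k (k ^ suc m))) within
      D≤B : length D ≤ B
      D≤B = ≤-trans (≤-reflexive (length-elements deleted))
                    (deletion-budget m (refine lab c) V (Fin-nonempty (c x₀)) within′ (≰⇒> ¬small))
      S′∖D? : ∀ x → Dec (deleteV S′ D x)
      S′∖D? x = S′? x ×-dec ¬? (map′ (∈-elements⁺ deleted x) (∈-elements⁻ deleted x) (deleted x ≟ᵇ true))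
      survives : ∀ y → deleteV S′ D y → Survives y
      survives y (y∈S′ , y∉D) with true-or-false (deleted y)
      ... | inj₁ y-deleted = ⊥-elim (y∉D (∈-elements⁺ deleted y y-deleted))
      ... | inj₂ y-kept = ⌊⌋-true (S′? y) y∈S′ , y-kept

lemma4p7 : (t k ℓ : ℕ) (r : ℕ∞) (G : SimpleGraph) →
    KttFree t G → frk≤ (3· r) k G ℓ → srk≤ r ((k ^ (2 ^ ℓ)) * (t ^ 2)) G ℓ
lemma4p7 t k zero r G free frk = ⊥-elim (¬frk-zero frk)
lemma4p7 t k (suc ℓ) r G free frk =
  follow frk {K = 1} (λ _ → zero) (λ _ _ → false) (λ _ _ → refl) unflipped within
         (λ _ → ⊤) (λ _ → yes tt) (λ _ _ → tt)
  where
  open Splitter G {{KttFree-nonZero G free}} free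
  t^2≡t*t : t ^ 2 ≡ t * t
  t^2≡t*t = cong (t *_) (*-identityʳ t)
  tight : k ≡ 1 → k ^ 2 ^ suc ℓ * t ^ 2 ≤ t * t
  tight refl = ≤-reflexive (trans (cong (_* t ^ 2) (^-zeroˡ (2 ^ suc ℓ))) (trans (*-identityˡ (t ^ 2)) t^2≡t*t))
  open Following r k (k ^ 2 ^ suc ℓ * t ^ 2) tight
  unflipped : ∀ x y → adj G x y ≡ flipBy {K = 1} (adj G) (λ _ → zero) (λ _ _ → false) x y
  unflipped x y = sym (trans (cong (adj G x y xor_) (∧-zeroʳ _)) (xor-identityʳ (adj G x y)))
  within : 1 * k ^ suc ℓ * (t * t) ≤ k ^ 2 ^ suc ℓ * t ^ 2
  within = *-mono-≤ (≤-trans (≤-reflexive (*-identityˡ (k ^ suc ℓ))) (^-≤-^-2^ k ℓ))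
                    (≤-reflexive (sym t^2≡t*t))
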